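{- If $n_1 \geq \cdots \geq n_k$, then \[ \sigma(\overline{K}_{n_1} \vee \cdots \vee \overline{K}_{n_k}) = \sigma(\overline{K}_{n_1} \vee \overline{K}_{n_2})= \begin{cases} n_1+1-n_2 & \text{ if $n_2 \leq \left\lfloor \frac{n_1+1}{2}\right\rfloor$,} \\ \left\lceil \frac{n_1+1}{2} \right\rceil & \text{ if $n_2 > \left\lfloor \frac{n_1+1}{2}\right\rfloor$.} \end{cases} \]
   Context: All graphs are finite, undirected and simple. $\overline{K}_n$ denotes the empty (edgeless) graph on $n$ vertices, so $\overline{K}_{n_1}\vee\cdots\vee\overline{K}_{n_k}$ is the complete multipartite graph with parts of sizes $n_1,\dots,n_k$ ($\vee$ is the join: disjoint union plus all edges between the graphs). $\alpha(G)$ is the independence number and $\Delta(G)$ the maximum degree. The sensitivity of a nonempty graph $G=(V,E)$ is $\sigma(G)=\min\{\Delta(G[S]) : S\subseteq V,\ |S|>\alpha(G)\}$. -}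

module Defs where

open import Data.Nat using (ℕ; zero; suc; _+_; _∸_; _≤_; _<_; _⊔_; _≤ᵇ_; _≡ᵇ_; ⌊_/2⌋; ⌈_/2⌉)
open import Data.Bool using (Bool; true; false; not; if_then_else_)
open import Data.Fin using (Fin; splitAt)
open import Data.Fin.Subset using (Subset; _∈_; _∩_; ∣_∣)
open import Data.Vec using (tabulate; lookup)
open import Data.List using (List; []; _∷_; map; foldr; allFin)
open import Data.Nat.ListAction using (sum)
open import Data.Sum using (inj₁; inj₂)
open import Data.Product using (Σ; ∃; _×_)
open import Relation.Binary.PropositionalEquality using (_≡_)

Adj : ℕ → Set
Adj N = Fin N → Fin N → Bool

Independent : ∀ {N} → Adj N → Subset N → Set
Independent {N} adj S = ∀ (x y : Fin N) → x ∈ S → y ∈ S → adj x y ≡ false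

IsIndependenceNumber : ∀ {N} → Adj N → ℕ → Set
IsIndependenceNumber {N} adj a =
  (∃ λ (S : Subset N) → Independent adj S × ∣ S ∣ ≡ a)
  × (∀ (S : Subset N) → Independent adj S → ∣ S ∣ ≤ a)

degIn : ∀ {N} → Adj N → Subset N → Fin N → ℕ
degIn adj S v = ∣ S ∩ tabulate (adj v) ∣

maxDegIn : ∀ {N} → Adj N → Subset N → ℕ
maxDegIn {N} adj S =
  foldr _⊔_ 0 (map (λ v → if lookup S v then degIn adj S v else 0) (allFin N))

IsSensitivity : ∀ {N} → Adj N → ℕ → Set
IsSensitivity {N} adj s =
  Σ ℕ λ a → IsIndependenceNumber adj a
    × (∃ λ (S : Subset N) → a < ∣ S ∣ × maxDegIn adj S ≡ s)
    × (∀ (S : Subset N) → a < ∣ S ∣ → s ≤ maxDegIn adj S)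

-- Complete multipartite graph with parts of sizes ns (in order).
-- Vertex set Fin (sum ns); the first n₁ vertices form part 0, the next n₂ part 1, etc.
partOf : (ns : List ℕ) → Fin (sum ns) → ℕ
partOf [] ()
partOf (n ∷ ns) v with splitAt n v
... | inj₁ _ = 0
... | inj₂ w = suc (partOf ns w)

completeMultipartite : (ns : List ℕ) → Adj (sum ns)
completeMultipartite ns v w = not (partOf ns v ≡ᵇ partOf ns w)

sensFormula : ℕ → ℕ → ℕ
sensFormula n₁ n₂ =
  if n₂ ≤ᵇ ⌊ suc n₁ /2⌋ then suc n₁ ∸ n₂ else ⌈ suc n₁ /2⌉

-- A complete multipartite graph is the graph on Fin N joining v and w iff they lie in different
-- classes of a labelling p, so the degree of v inside S is |S| minus the part of S in the class
-- of v.  Two consequences give the lower bound for every S larger than α = n₁: S has a vertex v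
-- outside the largest class, whose degree is at least |S| − n₂; and S has a vertex u adjacent to
-- v, and since the class of u inside S consists of neighbours of v, deg u + deg v ≥ |S| ≥ n₁ + 1.
-- The bound is attained by n₁ + 1 vertices taken from the two largest classes, split as evenly
-- as the second class allows.
module Submission where

open import Defs
open import Data.Bool using (Bool; true; false; not; _∧_; if_then_else_)
open import Data.Bool.Properties using (∧-identityʳ; ∧-zeroʳ; not-injective; T-≡)
open import Data.Fin using (Fin; zero; suc; toℕ; _↑ˡ_; _↑ʳ_; splitAt)
open import Data.Fin.Properties using (splitAt-↑ˡ; splitAt-↑ʳ)
open import Data.Fin.Subset using (Subset; _∈_; _∩_; ∣_∣)
open import Data.List using (List; []; _∷_; map; foldr; allFin)
open import Data.List.Membership.Propositional using () renaming (_∈_ to _∈ₗ_)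
open import Data.List.Membership.Propositional.Properties using (∈-allFin)
open import Data.List.Relation.Unary.All using (All; _∷_)
open import Data.List.Relation.Unary.Any using (here; there)
open import Data.List.Relation.Unary.Linked using (Linked; [-]; _∷_)
open import Data.Nat
open import Data.Nat.ListAction using (sum)
open import Data.Nat.Properties
open import Data.Product using (Σ; ∃; _×_; _,_)
open import Data.Sum using (_⊎_; inj₁; inj₂)
open import Data.Vec using ([]; _∷_; tabulate; lookup)
open import Data.Vec.Properties using (lookup∘tabulate; []=⇒lookup; lookup⇒[]=)
open import Function using (_∘_; case_of_; Equivalence)
open import Relation.Binary.PropositionalEquality

count : ∀ {n} → (Fin n → Bool) → ℕ
count {zero}  f = 0
count {suc n} f = (if f zero then 1 else 0) + count (f ∘ suc)

count-cong : ∀ {n} {f g : Fin n → Bool} → (∀ i → f i ≡ g i) → count f ≡ count g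
count-cong {zero}  f≗g = refl
count-cong {suc n} f≗g rewrite f≗g zero = cong (_ +_) (count-cong (f≗g ∘ suc))

count-false : ∀ {n} {f : Fin n → Bool} → (∀ i → f i ≡ false) → count f ≡ 0
count-false {zero}  f≗false = refl
count-false {suc n} f≗false rewrite f≗false zero = count-false (f≗false ∘ suc)

count-true : ∀ n → count {n} (λ _ → true) ≡ n
count-true zero    = refl
count-true (suc n) = cong suc (count-true n)

count-mono : ∀ {n} {f g : Fin n → Bool} → (∀ i → f i ≡ true → g i ≡ true) → count f ≤ count g
count-mono {zero}              f⇒g = z≤n
count-mono {suc n} {f} {g} f⇒g with f zero in f₀ | g zero in g₀
... | false | false = count-mono (f⇒g ∘ suc)
... | false | true  = m≤n⇒m≤1+n (count-mono (f⇒g ∘ suc))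
... | true  | true  = s≤s (count-mono (f⇒g ∘ suc))
... | true  | false with () ← trans (sym g₀) (f⇒g zero f₀)

count-<⇒∃ : ∀ {n} {f g : Fin n → Bool} → count g < count f → ∃ λ i → f i ≡ true × g i ≡ false
count-<⇒∃ {suc n} {f} {g} g<f with f zero in f₀ | g zero in g₀
... | true  | false = zero , f₀ , g₀
... | false | false = let i , fi , gi = count-<⇒∃ g<f in suc i , fi , gi
... | false | true  = let i , fi , gi = count-<⇒∃ (<⇒≤ g<f) in suc i , fi , gi
... | true  | true  = let i , fi , gi = count-<⇒∃ (s<s⁻¹ g<f) in suc i , fi , gi

count-pos⇒∃ : ∀ {n} {f : Fin n → Bool} → 0 < count f → ∃ λ i → f i ≡ true
count-pos⇒∃ {n} {f} pos =
  let count-false≡0 = count-false {n} {λ _ → false} (λ _ → refl)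
      i , fi , _    = count-<⇒∃ {g = λ _ → false} (subst (_< count f) (sym count-false≡0) pos)
  in i , fi

count-∧-split : ∀ {n} (f g : Fin n → Bool) →
                count (λ i → f i ∧ g i) + count (λ i → f i ∧ not (g i)) ≡ count f
count-∧-split {zero}  f g = refl
count-∧-split {suc n} f g with f zero | g zero | count-∧-split (f ∘ suc) (g ∘ suc)
... | false | _     | split = split
... | true  | true  | split = cong suc split
... | true  | false | split = trans (+-suc (count (λ i → f (suc i) ∧ g (suc i))) _) (cong suc split)

count-∧-const : ∀ {n} (f : Fin n → Bool) b → count (λ i → f i ∧ b) ≡ (if b then count f else 0)
count-∧-const f true  = count-cong (λ i → ∧-identityʳ (f i))
count-∧-const f false = count-false (λ i → ∧-zeroʳ (f i))

count-↑ : ∀ m {n} (f : Fin (m + n) → Bool) →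
          count f ≡ count (λ i → f (i ↑ˡ n)) + count (λ i → f (m ↑ʳ i))
count-↑ zero    f = refl
count-↑ (suc m) f = trans (cong (f₀ +_) (count-↑ m (f ∘ suc))) (sym (+-assoc f₀ _ _))
  where f₀ = if f zero then 1 else 0

count-<ᵇ : ∀ {n} a → a ≤ n → count {n} (λ i → toℕ i <ᵇ a) ≡ a
count-<ᵇ {zero}  zero    _         = refl
count-<ᵇ {suc n} zero    _         = count-false {n} {λ i → toℕ (suc i) <ᵇ 0} (λ _ → refl)
count-<ᵇ         (suc a) (s≤s a≤n) = cong suc (count-<ᵇ a a≤n)

count-<ᵇ-∧ : ∀ {n} a → a ≤ n → ∀ b → count {n} (λ i → (toℕ i <ᵇ a) ∧ b) ≡ (if b then a else 0)
count-<ᵇ-∧ {n} a a≤n true  = trans (count-∧-const {n} (λ i → toℕ i <ᵇ a) true) (count-<ᵇ a a≤n)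
count-<ᵇ-∧ {n} a a≤n false = count-∧-const {n} (λ i → toℕ i <ᵇ a) false

∣S∣≡count : ∀ {n} (S : Subset n) → ∣ S ∣ ≡ count (lookup S)
∣S∣≡count []          = refl
∣S∣≡count (true ∷ S)  = cong suc (∣S∣≡count S)
∣S∣≡count (false ∷ S) = ∣S∣≡count S

∣S∩tabulate∣≡count : ∀ {n} (S : Subset n) (g : Fin n → Bool) →
                     ∣ S ∩ tabulate g ∣ ≡ count (λ i → lookup S i ∧ g i)
∣S∩tabulate∣≡count []          g = refl
∣S∩tabulate∣≡count (false ∷ S) g = ∣S∩tabulate∣≡count S (g ∘ suc)
∣S∩tabulate∣≡count (true ∷ S)  g with g zero
... | true  = cong suc (∣S∩tabulate∣≡count S (g ∘ suc))
... | false = ∣S∩tabulate∣≡count S (g ∘ suc)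

foldr-⊔-≥ : ∀ {a} {A : Set a} (F : A → ℕ) {x xs} → x ∈ₗ xs → F x ≤ foldr _⊔_ 0 (map F xs)
foldr-⊔-≥ F {xs = y ∷ _} (here refl) = m≤m⊔n (F y) _
foldr-⊔-≥ F {xs = y ∷ _} (there x∈)  = m≤n⇒m≤o⊔n (F y) (foldr-⊔-≥ F x∈)

foldr-⊔-≤ : ∀ {a} {A : Set a} (F : A → ℕ) xs {k} → (∀ x → F x ≤ k) → foldr _⊔_ 0 (map F xs) ≤ k
foldr-⊔-≤ F []       F≤k = z≤n
foldr-⊔-≤ F (x ∷ xs) F≤k = ⊔-lub (F≤k x) (foldr-⊔-≤ F xs F≤k)

module _ {N} (adj : Adj N) (S : Subset N) where

  degIn-≤-maxDegIn : ∀ v → lookup S v ≡ true → degIn adj S v ≤ maxDegIn adj S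
  degIn-≤-maxDegIn v v∈S =
    subst (_≤ maxDegIn adj S) (cong (λ b → if b then degIn adj S v else 0) v∈S)
          (foldr-⊔-≥ (λ w → if lookup S w then degIn adj S w else 0) (∈-allFin v))

  maxDegIn-≤ : ∀ {k} → (∀ v → lookup S v ≡ true → degIn adj S v ≤ k) → maxDegIn adj S ≤ k
  maxDegIn-≤ deg≤k = foldr-⊔-≤ _ (allFin N) bound
    where
    bound : ∀ v → (if lookup S v then degIn adj S v else 0) ≤ _
    bound v with lookup S v in v∈S
    ... | true  = deg≤k v v∈S
    ... | false = z≤n

⌈/2⌉≤ : ∀ {m} n → m ≤ n + n → ⌈ m /2⌉ ≤ n
⌈/2⌉≤ n m≤2n = ≤-trans (⌈n/2⌉-mono m≤2n) (≤-reflexive (sym (n≡⌈n+n/2⌉ n)))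

sensFormula-≤ : ∀ n₁ n₂ {d} → suc n₁ ∸ n₂ ≤ d → ⌈ suc n₁ /2⌉ ≤ d → sensFormula n₁ n₂ ≤ d
sensFormula-≤ n₁ n₂ large≤d half≤d with n₂ ≤ᵇ ⌊ suc n₁ /2⌋
... | true  = large≤d
... | false = half≤d

-- The two numbers of vertices to take from the two largest classes.
sensFormula-split : ∀ {n₁ n₂} → 1 ≤ n₂ → n₂ ≤ n₁ →
  Σ ℕ λ a → Σ ℕ λ b → a + b ≡ suc n₁ × b ≤ a × a ≤ n₁ × b ≤ n₂ × a ≡ sensFormula n₁ n₂
sensFormula-split {n₁} {n₂} 1≤n₂ n₂≤n₁ with n₂ ≤ᵇ ⌊ suc n₁ /2⌋ in small
... | true  = suc n₁ ∸ n₂ , n₂ , m∸n+n≡m (m+n≤o⇒m≤o n₂ 2n₂≤) , m+n≤o⇒m≤o∸n n₂ 2n₂≤ ,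
              ∸-monoʳ-≤ (suc n₁) 1≤n₂ , ≤-refl , refl
  where
  n₂≤half : n₂ ≤ ⌊ suc n₁ /2⌋
  n₂≤half = ≤ᵇ⇒≤ n₂ _ (Equivalence.from T-≡ small)
  2n₂≤ : n₂ + n₂ ≤ suc n₁
  2n₂≤ = begin
    n₂ + n₂                       ≤⟨ +-mono-≤ n₂≤half (≤-trans n₂≤half (⌊n/2⌋≤⌈n/2⌉ (suc n₁))) ⟩
    ⌊ suc n₁ /2⌋ + ⌈ suc n₁ /2⌉   ≡⟨ ⌊n/2⌋+⌈n/2⌉≡n (suc n₁) ⟩
    suc n₁                        ∎
    where open ≤-Reasoning
... | false = ⌈ suc n₁ /2⌉ , ⌊ suc n₁ /2⌋ , trans (+-comm ⌈ suc n₁ /2⌉ _) (⌊n/2⌋+⌈n/2⌉≡n (suc n₁)) ,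
              ⌊n/2⌋≤⌈n/2⌉ (suc n₁) , half≤n₁ n₁ (≤-trans 1≤n₂ n₂≤n₁) , half≤n₂ , refl
  where
  half≤n₁ : ∀ n → 1 ≤ n → ⌈ suc n /2⌉ ≤ n
  half≤n₁ (suc n) _ = s<s⁻¹ (⌈n/2⌉<n n)
  half≤n₂ : ⌊ suc n₁ /2⌋ ≤ n₂
  half≤n₂ = ≮⇒≥ λ n₂<half →
    case trans (sym small) (Equivalence.to T-≡ (≤⇒≤ᵇ (<⇒≤ n₂<half))) of λ ()

≡ᵇ-refl : ∀ n → (n ≡ᵇ n) ≡ true
≡ᵇ-refl n = Equivalence.to T-≡ (≡⇒≡ᵇ n n refl)

-- completeMultipartite ns is definitionally adj for p = partOf ns.
module ClassGraph {N} (p : Fin N → ℕ) where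

  adj : Adj N
  adj v w = not (p v ≡ᵇ p w)

  inClass : ℕ → Fin N → Bool
  inClass c w = c ≡ᵇ p w

  classSize : ℕ → ℕ
  classSize c = count (inClass c)

  inClass⇒≡ : ∀ c w → inClass c w ≡ true → c ≡ p w
  inClass⇒≡ c w w∈c = ≡ᵇ⇒≡ c (p w) (Equivalence.from T-≡ w∈c)

  count-∩-inClass≤classSize : ∀ S c → count (λ w → lookup S w ∧ inClass c w) ≤ classSize c
  count-∩-inClass≤classSize S c = count-mono λ w → ∧-elimʳ (lookup S w)
    where
    ∧-elimʳ : ∀ x {y} → x ∧ y ≡ true → y ≡ true
    ∧-elimʳ true y≡true = y≡true

  inClass+degIn≡∣S∣ : ∀ S v → count (λ w → lookup S w ∧ inClass (p v) w) + degIn adj S v ≡ ∣ S ∣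
  inClass+degIn≡∣S∣ S v = begin
    count (λ w → lookup S w ∧ inClass (p v) w) + degIn adj S v
      ≡⟨ cong (count (λ w → lookup S w ∧ inClass (p v) w) +_) (∣S∩tabulate∣≡count S (adj v)) ⟩
    count (λ w → lookup S w ∧ inClass (p v) w) + count (λ w → lookup S w ∧ not (inClass (p v) w))
      ≡⟨ count-∧-split (lookup S) (inClass (p v)) ⟩
    count (lookup S)
      ≡⟨ sym (∣S∣≡count S) ⟩
    ∣ S ∣ ∎
    where open ≡-Reasoning

  ∣S∣∸classSize≤degIn : ∀ S v → ∣ S ∣ ∸ classSize (p v) ≤ degIn adj S v
  ∣S∣∸classSize≤degIn S v = begin
    ∣ S ∣ ∸ classSize (p v)               ≤⟨ ∸-monoʳ-≤ ∣ S ∣ (count-∩-inClass≤classSize S (p v)) ⟩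
    ∣ S ∣ ∸ sameClass                     ≡⟨ cong (_∸ sameClass) (inClass+degIn≡∣S∣ S v) ⟨
    sameClass + degIn adj S v ∸ sameClass ≡⟨ m+n∸m≡n sameClass _ ⟩
    degIn adj S v                         ∎
    where
    open ≤-Reasoning
    sameClass = count (λ w → lookup S w ∧ inClass (p v) w)

  ∣S∣≤degIn+degIn : ∀ S {u v} → adj v u ≡ true → ∣ S ∣ ≤ degIn adj S u + degIn adj S v
  ∣S∣≤degIn+degIn S {u} {v} vu = begin
    ∣ S ∣                         ≡⟨ inClass+degIn≡∣S∣ S u ⟨
    classOfU + degIn adj S u      ≤⟨ +-monoˡ-≤ _ classOfU≤degIn ⟩
    degIn adj S v + degIn adj S u ≡⟨ +-comm (degIn adj S v) _ ⟩
    degIn adj S u + degIn adj S v ∎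
    where
    open ≤-Reasoning
    classOfU = count (λ w → lookup S w ∧ inClass (p u) w)
    neighbourOfV : ∀ w → lookup S w ∧ inClass (p u) w ≡ true →
                         lookup S w ∧ not (inClass (p v) w) ≡ true
    neighbourOfV w w∈ with lookup S w
    ... | true = subst (λ x → not (p v ≡ᵇ x) ≡ true) (inClass⇒≡ (p u) w w∈) vu
    classOfU≤degIn : classOfU ≤ degIn adj S v
    classOfU≤degIn = subst (classOfU ≤_) (sym (∣S∩tabulate∣≡count S (adj v))) (count-mono neighbourOfV)

  ∃-outside-class : ∀ S c → classSize c < ∣ S ∣ → ∃ λ v → lookup S v ≡ true × inClass c v ≡ false
  ∃-outside-class S c c<S = count-<⇒∃ (subst (classSize c <_) (∣S∣≡count S) c<S)

  independent⇒∣S∣≤classSize : ∀ S → Independent adj S → ∀ {v} → lookup S v ≡ true →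
                               ∣ S ∣ ≤ classSize (p v)
  independent⇒∣S∣≤classSize S indep {v} v∈S =
    subst (_≤ classSize (p v)) (sym (∣S∣≡count S)) (count-mono sameClass)
    where
    sameClass : ∀ w → lookup S w ≡ true → inClass (p v) w ≡ true
    sameClass w w∈S = not-injective (indep v w (lookup⇒[]= v S v∈S) (lookup⇒[]= w S w∈S))

  inClass-independent : ∀ c → Independent adj (tabulate (inClass c))
  inClass-independent c x y x∈ y∈ =
    subst₂ (λ px py → not (px ≡ᵇ py) ≡ false) (inClass⇒≡ c x (member x∈)) (inClass⇒≡ c y (member y∈))
           (cong not (≡ᵇ-refl c))
    where
    member : ∀ {w} → w ∈ tabulate (inClass c) → inClass c w ≡ true
    member {w} w∈ = trans (sym (lookup∘tabulate (inClass c) w)) ([]=⇒lookup w∈)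

  classSize-isIndependenceNumber : ∀ {a} c → classSize c ≡ a → (∀ c′ → classSize c′ ≤ a) →
                                   IsIndependenceNumber adj a
  classSize-isIndependenceNumber {a} c c≡a classes≤a =
    (tabulate (inClass c) , inClass-independent c , ∣class∣≡a) , independent⇒≤a
    where
    ∣class∣≡a : ∣ tabulate (inClass c) ∣ ≡ a
    ∣class∣≡a = trans (∣S∣≡count (tabulate (inClass c)))
                      (trans (count-cong (lookup∘tabulate (inClass c))) c≡a)
    independent⇒≤a : ∀ S → Independent adj S → ∣ S ∣ ≤ a
    independent⇒≤a S indep = ≮⇒≥ λ a<S →
      let v , v∈S = count-pos⇒∃ (subst (0 <_) (∣S∣≡count S) (≤-<-trans z≤n a<S))
      in <⇒≱ a<S (≤-trans (independent⇒∣S∣≤classSize S indep v∈S) (classes≤a (p v)))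

  sensFormula≤maxDegIn : ∀ {n₁ n₂} → (∀ c → classSize c ≤ n₁) → (∀ c → classSize (suc c) ≤ n₂) →
                         n₂ ≤ n₁ → ∀ S → n₁ < ∣ S ∣ → sensFormula n₁ n₂ ≤ maxDegIn adj S
  sensFormula≤maxDegIn {n₁} {n₂} classes≤n₁ others≤n₂ n₂≤n₁ S n₁<S =
    let v , v∈S , v∉₀ = ∃-outside-class S 0 (≤-<-trans (classes≤n₁ 0) n₁<S)
        class-v≤n₂    = outside₀⇒classSize≤n₂ v v∉₀
        u , u∈S , u∉v = ∃-outside-class S (p v) (≤-<-trans (≤-trans class-v≤n₂ n₂≤n₁) n₁<S)
    in sensFormula-≤ n₁ n₂
         (begin
            suc n₁ ∸ n₂                  ≤⟨ ∸-monoˡ-≤ n₂ n₁<S ⟩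
            ∣ S ∣ ∸ n₂                   ≤⟨ ∸-monoʳ-≤ ∣ S ∣ class-v≤n₂ ⟩
            ∣ S ∣ ∸ classSize (p v)      ≤⟨ ∣S∣∸classSize≤degIn S v ⟩
            degIn adj S v                ≤⟨ degIn-≤-maxDegIn adj S v v∈S ⟩
            maxDegIn adj S               ∎)
         (⌈/2⌉≤ (maxDegIn adj S) (begin
            suc n₁                        ≤⟨ n₁<S ⟩
            ∣ S ∣                         ≤⟨ ∣S∣≤degIn+degIn S (cong not u∉v) ⟩
            degIn adj S u + degIn adj S v ≤⟨ +-mono-≤ (degIn-≤-maxDegIn adj S u u∈S)
                                                      (degIn-≤-maxDegIn adj S v v∈S) ⟩
            maxDegIn adj S + maxDegIn adj S ∎))
    where
    open ≤-Reasoning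
    outside₀⇒classSize≤n₂ : ∀ v → inClass 0 v ≡ false → classSize (p v) ≤ n₂
    outside₀⇒classSize≤n₂ v v∉₀ with p v | v∉₀
    ... | suc c | _ = others≤n₂ c

partSize : List ℕ → ℕ → ℕ
partSize []       _       = 0
partSize (n ∷ _)  zero    = n
partSize (_ ∷ ns) (suc j) = partSize ns j

partSize≤head : ∀ {n ns} → Linked _≥_ (n ∷ ns) → ∀ j → partSize (n ∷ ns) j ≤ n
partSize≤head {ns = []}     _              (suc j) = z≤n
partSize≤head {ns = _ ∷ _}  (n≥m ∷ sorted) (suc j) = ≤-trans (partSize≤head sorted j) n≥m
partSize≤head               _              zero    = ≤-refl

partOf-↑ˡ : ∀ n ns (i : Fin n) → partOf (n ∷ ns) (i ↑ˡ sum ns) ≡ 0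
partOf-↑ˡ n ns i rewrite splitAt-↑ˡ n i (sum ns) = refl

partOf-↑ʳ : ∀ n ns (w : Fin (sum ns)) → partOf (n ∷ ns) (n ↑ʳ w) ≡ suc (partOf ns w)
partOf-↑ʳ n ns w rewrite splitAt-↑ʳ n (sum ns) w = refl

classSize-partOf : ∀ ns j → ClassGraph.classSize (partOf ns) j ≡ partSize ns j
classSize-partOf []       j       = refl
classSize-partOf (n ∷ ns) zero    = trans (count-↑ n _) (trans
  (cong₂ _+_ (trans (count-cong (λ i → cong (0 ≡ᵇ_) (partOf-↑ˡ n ns i))) (count-true n))
             (count-false (λ w → cong (0 ≡ᵇ_) (partOf-↑ʳ n ns w))))
  (+-identityʳ n))
classSize-partOf (n ∷ ns) (suc j) = trans (count-↑ n _)
  (cong₂ _+_ (count-false (λ i → cong (suc j ≡ᵇ_) (partOf-↑ˡ n ns i)))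
             (trans (count-cong (λ w → cong (suc j ≡ᵇ_) (partOf-↑ʳ n ns w))) (classSize-partOf ns j)))

module FirstTwoParts (n₁ n₂ : ℕ) (rest : List ℕ) where

  open ClassGraph (partOf (n₁ ∷ n₂ ∷ rest))

  p : Fin (n₁ + (n₂ + sum rest)) → ℕ
  p = partOf (n₁ ∷ n₂ ∷ rest)

  select : ℕ → ℕ → Fin (n₁ + (n₂ + sum rest)) → Bool
  select a b v with splitAt n₁ v
  ... | inj₁ i = toℕ i <ᵇ a
  ... | inj₂ w with splitAt n₂ w
  ... | inj₁ i = toℕ i <ᵇ b
  ... | inj₂ _ = false

  select⇒part≤1 : ∀ {a b} v → select a b v ≡ true → p v ≡ 0 ⊎ p v ≡ 1
  select⇒part≤1 v v∈ with splitAt n₁ v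
  ... | inj₁ _ = inj₁ refl
  ... | inj₂ w with splitAt n₂ w
  ... | inj₁ _ = inj₂ refl
  select⇒part≤1 v () | inj₂ _ | inj₂ _

  module _ {a b} (a≤n₁ : a ≤ n₁) (b≤n₂ : b ≤ n₂) where

    count-select-∧ : ∀ (g : ℕ → Bool) →
      count (λ v → select a b v ∧ g (p v)) ≡ (if g 0 then a else 0) + (if g 1 then b else 0)
    count-select-∧ g = trans (count-↑ n₁ _) (cong₂ _+_ part₀
      (trans (count-↑ n₂ _) (trans (cong₂ _+_ part₁ others) (+-identityʳ _))))
      where
      part₀ : count {n₁} (λ i → select a b (i ↑ˡ (n₂ + sum rest)) ∧ g (p (i ↑ˡ (n₂ + sum rest)))) ≡ _
      part₀ = trans (count-cong λ i → cong₂ (λ x k → x ∧ g k) (select-↑ˡ i) (partOf-↑ˡ n₁ (n₂ ∷ rest) i))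
                    (count-<ᵇ-∧ {n₁} a a≤n₁ (g 0))
        where
        select-↑ˡ : ∀ i → select a b (i ↑ˡ (n₂ + sum rest)) ≡ (toℕ i <ᵇ a)
        select-↑ˡ i rewrite splitAt-↑ˡ n₁ i (n₂ + sum rest) = refl
      part₁ : count {n₂} (λ i → select a b (n₁ ↑ʳ (i ↑ˡ sum rest)) ∧ g (p (n₁ ↑ʳ (i ↑ˡ sum rest)))) ≡ _
      part₁ = trans (count-cong λ i → cong₂ (λ x k → x ∧ g k) (select-↑ʳ↑ˡ i)
                      (trans (partOf-↑ʳ n₁ (n₂ ∷ rest) _) (cong suc (partOf-↑ˡ n₂ rest i))))
                    (count-<ᵇ-∧ {n₂} b b≤n₂ (g 1))
        where
        select-↑ʳ↑ˡ : ∀ i → select a b (n₁ ↑ʳ (i ↑ˡ sum rest)) ≡ (toℕ i <ᵇ b)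
        select-↑ʳ↑ˡ i rewrite splitAt-↑ʳ n₁ (n₂ + sum rest) (i ↑ˡ sum rest)
                            | splitAt-↑ˡ n₂ i (sum rest) = refl
      others : count {sum rest} (λ i → select a b (n₁ ↑ʳ (n₂ ↑ʳ i)) ∧ g (p (n₁ ↑ʳ (n₂ ↑ʳ i)))) ≡ 0
      others = count-false λ i → cong (λ x → x ∧ g (p (n₁ ↑ʳ (n₂ ↑ʳ i)))) (select-↑ʳ↑ʳ i)
        where
        select-↑ʳ↑ʳ : ∀ i → select a b (n₁ ↑ʳ (n₂ ↑ʳ i)) ≡ false
        select-↑ʳ↑ʳ i rewrite splitAt-↑ʳ n₁ (n₂ + sum rest) (n₂ ↑ʳ i) | splitAt-↑ʳ n₂ (sum rest) i = refl

    ∣select∣ : ∣ tabulate (select a b) ∣ ≡ a + b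
    ∣select∣ = begin
      ∣ tabulate (select a b) ∣              ≡⟨ ∣S∣≡count (tabulate (select a b)) ⟩
      count (lookup (tabulate (select a b))) ≡⟨ count-cong (lookup∘tabulate (select a b)) ⟩
      count (select a b)                     ≡⟨ count-cong (λ v → sym (∧-identityʳ (select a b v))) ⟩
      count (λ v → select a b v ∧ true)      ≡⟨ count-select-∧ (λ _ → true) ⟩
      a + b                                  ∎
      where open ≡-Reasoning

    degIn-select : ∀ v → degIn adj (tabulate (select a b)) v ≡
                         (if not (p v ≡ᵇ 0) then a else 0) + (if not (p v ≡ᵇ 1) then b else 0)
    degIn-select v = begin
      degIn adj (tabulate (select a b)) v
        ≡⟨ ∣S∩tabulate∣≡count (tabulate (select a b)) (adj v) ⟩
      count (λ w → lookup (tabulate (select a b)) w ∧ adj v w)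
        ≡⟨ count-cong (λ w → cong (_∧ adj v w) (lookup∘tabulate (select a b) w)) ⟩
      count (λ w → select a b w ∧ not (p v ≡ᵇ p w))
        ≡⟨ count-select-∧ (λ k → not (p v ≡ᵇ k)) ⟩
      (if not (p v ≡ᵇ 0) then a else 0) + (if not (p v ≡ᵇ 1) then b else 0) ∎
      where open ≡-Reasoning

    maxDegIn-select≤ : b ≤ a → maxDegIn adj (tabulate (select a b)) ≤ a
    maxDegIn-select≤ b≤a = maxDegIn-≤ adj (tabulate (select a b)) λ v v∈S →
      subst (_≤ a) (sym (degIn-select v))
            (bound v (select⇒part≤1 v (trans (sym (lookup∘tabulate (select a b) v)) v∈S)))
      where
      bound : ∀ v → p v ≡ 0 ⊎ p v ≡ 1 →
              (if not (p v ≡ᵇ 0) then a else 0) + (if not (p v ≡ᵇ 1) then b else 0) ≤ a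
      bound v (inj₁ pv≡0) rewrite pv≡0 = b≤a
      bound v (inj₂ pv≡1) rewrite pv≡1 = ≤-reflexive (+-identityʳ a)

sensitivity-completeMultipartite : ∀ n₁ n₂ rest → Linked _≥_ (n₁ ∷ n₂ ∷ rest) → 1 ≤ n₂ →
                                   IsSensitivity (completeMultipartite (n₁ ∷ n₂ ∷ rest)) (sensFormula n₁ n₂)
sensitivity-completeMultipartite n₁ n₂ rest sorted@(n₂≤n₁ ∷ sorted₂) 1≤n₂ =
  let a , b , a+b≡ , b≤a , a≤n₁ , b≤n₂ , a≡formula = sensFormula-split 1≤n₂ n₂≤n₁
      S    = tabulate (select a b)
      n₁<S = subst (n₁ <_) (sym (trans (∣select∣ a≤n₁ b≤n₂) a+b≡)) ≤-refl
      S≤formula = subst (maxDegIn adj S ≤_) a≡formula (maxDegIn-select≤ a≤n₁ b≤n₂ b≤a)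
  in n₁ , α≡n₁ , (S , n₁<S , ≤-antisym S≤formula (formula≤ S n₁<S)) , formula≤
  where
  open ClassGraph (partOf (n₁ ∷ n₂ ∷ rest))
  open FirstTwoParts n₁ n₂ rest using (select; ∣select∣; maxDegIn-select≤)
  classes≤n₁ : ∀ c → classSize c ≤ n₁
  classes≤n₁ c = subst (_≤ n₁) (sym (classSize-partOf (n₁ ∷ n₂ ∷ rest) c)) (partSize≤head sorted c)
  others≤n₂ : ∀ c → classSize (suc c) ≤ n₂
  others≤n₂ c = subst (_≤ n₂) (sym (classSize-partOf (n₁ ∷ n₂ ∷ rest) (suc c))) (partSize≤head sorted₂ c)
  α≡n₁ : IsIndependenceNumber adj n₁
  α≡n₁ = classSize-isIndependenceNumber 0 (classSize-partOf (n₁ ∷ n₂ ∷ rest) 0) classes≤n₁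
  formula≤ : ∀ S → n₁ < ∣ S ∣ → sensFormula n₁ n₂ ≤ maxDegIn adj S
  formula≤ = sensFormula≤maxDegIn classes≤n₁ others≤n₂ n₂≤n₁

proposition3p11 : (n₁ n₂ : ℕ) (rest : List ℕ)
    → Linked _≥_ (n₁ ∷ n₂ ∷ rest)
    → All (1 ≤_) (n₁ ∷ n₂ ∷ rest)
    → IsSensitivity (completeMultipartite (n₁ ∷ n₂ ∷ rest)) (sensFormula n₁ n₂)
    × IsSensitivity (completeMultipartite (n₁ ∷ n₂ ∷ [])) (sensFormula n₁ n₂)
proposition3p11 n₁ n₂ rest sorted@(n₂≤n₁ ∷ _) (_ ∷ 1≤n₂ ∷ _) =
  sensitivity-completeMultipartite n₁ n₂ rest sorted 1≤n₂ ,
  sensitivity-completeMultipartite n₁ n₂ [] (n₂≤n₁ ∷ [-]) 1≤n₂
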